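{- Let $A(q)=\prod_{j} f_j^{n_j}=:\sum_{n=0}^{\infty}a_nq^n$ be any eta quotient (a finite product, $j\in\mathbb{N}$, $n_j\in\mathbb{Z}$) such that $n_1$ is odd, and $n_j$ is even for every odd $j>1$. Let \[ B(q)=A(q)\frac{f_1^2f_2}{f_4}=:\sum_{n=0}^{\infty}b_nq^n. \] Then for all integers $n\ge 0$, \[ a_{2n}-b_{2n}\equiv 0 \pmod 4,\qquad a_{2n+1}+b_{2n+1}\equiv 0\pmod 4. \]
   Context: For $|q|<1$ and positive integers $j$, $f_j:=\prod_{n=1}^{\infty}(1-q^{jn})$. An eta quotient is a finite product $\prod_j f_j^{n_j}$ with $j\in\mathbb{N}$, $n_j\in\mathbb{Z}$; its power series expansion in $q$ has integer coefficients. -}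

module Defs where

open import Data.Nat as ℕ using (ℕ; zero; suc; _∸_)
open import Data.Integer as ℤ using (ℤ; +_; -[1+_]; _+_; _*_; -_)
open import Relation.Nullary using (yes; no)
open import Data.List using (List; []; _∷_; map; foldr; upTo; zipWith)

PS : Set
PS = ℕ → ℤ

Σℤ : List ℤ → ℤ
Σℤ = foldr _+_ (+ 0)

-- Kronecker delta: coefficient sequence of the monomial q^k
δ : ℕ → ℕ → ℤ
δ k n with k ℕ.≟ n
... | yes _ = + 1
... | no _ = + 0

one : PS
one = δ 0

_⊛_ : PS → PS → PS
(a ⊛ b) n = Σℤ (map (λ k → a k * b (n ∸ k)) (upTo (suc n)))

infixl 7 _⊛_

powN : PS → ℕ → PS
powN f zero = one
powN f (suc m) = f ⊛ powN f m

-- Multiplicative inverse of a power series with constant term 1: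
-- b₀ = 1, b_{n+1} = - Σ_{k=1}^{n+1} a_k b_{n+1-k}.
-- invRev a n = [b_n, b_{n-1}, ..., b_0]
invRev : PS → ℕ → List ℤ
invRev a zero = + 1 ∷ []
invRev a (suc n) =
  (- Σℤ (zipWith _*_ (map (λ i → a (suc i)) (upTo (suc n))) (invRev a n)))
  ∷ invRev a n

inv : PS → PS
inv a n with invRev a n
... | b ∷ _ = b
... | [] = + 0

-- integer powers (negative powers via inv; used only for series with constant term 1)
zpow : PS → ℤ → PS
zpow f (+ m) = powN f m
zpow f -[1+ m ] = powN (inv f) (suc m)

oneMinusQ : ℕ → PS
oneMinusQ k n = δ 0 n ℤ.- δ k n

partialProd : ℕ → ℕ → PS
partialProd j zero = one
partialProd j (suc M) = oneMinusQ (j ℕ.* suc M) ⊛ partialProd j M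

-- f_j = ∏_{m≥1} (1 - q^{j m}) for j ≥ 1: its q^n coefficient agrees with
-- that of the partial product up to m = n (factors with m > n only affect
-- coefficients of q^{jm}, jm > n).
f : ℕ → PS
f j n = partialProd j n n

etaQuot : ℕ → (ℕ → ℤ) → PS
etaQuot zero e = one
etaQuot (suc N) e = zpow (f (suc N)) (e (suc N)) ⊛ etaQuot N e

-- Write A(-q) for the series with coefficients (-1)ⁿ aₙ; the claim is that B ≡ A(-q) (mod 4)
-- coefficientwise. The substitution q ↦ -q is a ring endomorphism fixing f_j for even j, and
-- every integer series satisfies A(-q) ≡ A (mod 2), hence A(-q)² ≡ A² (mod 4). So the ratio
-- H_j = f_j(-q)/f_j satisfies H_j² ≡ 1 (mod 4), and f_j^{n_j}(-q) ≡ f_j^{n_j} (mod 4) whenever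
-- j or n_j is even, while f_1^{n_1}(-q) ≡ f_1^{n_1} H_1 as n_1 is odd; thus A(-q) ≡ A H_1.
-- Finally f_1(-q) f_1 f_4 = f_2³ and f_1⁴ ≡ f_2² (mod 4) (the square of the Frobenius
-- congruence f_1² ≡ f_2 mod 2) give H_1 = f_2³/(f_1² f_4) ≡ f_1² f_2/f_4 (mod 4), i.e.
-- A H_1 ≡ B. Identities between the infinite products are proved for partial products:
-- the n-th coefficient of f_j is already that of the product of its first n factors.
module Submission where

open import Defs
open import Data.Nat as ℕ using (ℕ; suc; _<_; _%_)
open import Data.Integer as ℤ using (ℤ; +_; _+_; _-_)
open import Data.Integer.Divisibility using (_∣_)
open import Relation.Binary.PropositionalEquality using (_≡_)
open import Relation.Nullary using (¬_)
import Data.Product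

open import Algebra.Bundles using (CommutativeRing)
import Algebra.Construct.Pointwise ℕ as Pointwise
import Algebra.Properties.CommutativeSemigroup as CommSemigroupProperties
import Algebra.Solver.Ring
open import Algebra.Solver.Ring.AlmostCommutativeRing using (_-Raw-AlmostCommutative⟶_; fromCommutativeRing)
open import Algebra.Structures using (IsCommutativeRing)
open import Data.Integer using (-[1+_]; -_; _*_; _^_; 0ℤ; 1ℤ)
import Data.Integer.Divisibility.Signed as Signed
import Data.Integer.Properties as ℤₚ
open import Data.Integer.Tactic.RingSolver using (solve-∀)
open import Data.List using (_∷_; applyUpTo; map; upTo; zipWith)
import Data.List.Properties as List
open import Data.Maybe using (Maybe; just; nothing)
open import Data.Nat using (zero; _∸_; _≤_; z≤n; s≤s)
open import Data.Nat.Divisibility using (divides) renaming (_∣_ to _∣ₙ_)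
open import Data.Nat.DivMod using ([m+kn]%n≡m%n)
import Data.Nat.Properties as ℕₚ
import Data.Nat.Tactic.RingSolver as ℕ-Solver
open import Data.Product using (Σ; _,_; _×_)
open import Data.Sum using (_⊎_; inj₁; inj₂)
open import Function using (_∘_)
open import Level using (0ℓ)
open import Relation.Binary.Bundles using (Setoid)
open import Relation.Binary.PropositionalEquality
  using (_≗_; _≢_; refl; sym; trans; cong; cong₂; subst; subst₂; module ≡-Reasoning)
import Relation.Binary.Reasoning.Setoid as SetoidReasoning
open import Relation.Nullary using (yes; no; contradiction)

open CommSemigroupProperties ℤₚ.+-commutativeSemigroup
  using () renaming (interchange to +-interchange; x∙yz≈y∙xz to x+[y+z]≡y+[x+z])
open CommSemigroupProperties ℤₚ.*-commutativeSemigroup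
  using () renaming (interchange to *-interchange)

-- Finite sums and the Cauchy product

∑ : ℕ → (ℕ → ℤ) → ℤ
∑ n g = Σℤ (applyUpTo g n)

∑-cong : ∀ n g h → (∀ k → k < n → g k ≡ h k) → ∑ n g ≡ ∑ n h
∑-cong zero    g h g≡h = refl
∑-cong (suc n) g h g≡h =
  cong₂ _+_ (g≡h 0 (s≤s z≤n)) (∑-cong n (g ∘ suc) (h ∘ suc) (λ k k<n → g≡h (suc k) (s≤s k<n)))

∑-+ : ∀ n g h → ∑ n (λ k → g k + h k) ≡ ∑ n g + ∑ n h
∑-+ zero    g h = refl
∑-+ (suc n) g h = trans (cong (_+_ (g 0 + h 0)) (∑-+ n (g ∘ suc) (h ∘ suc)))
                        (+-interchange (g 0) (h 0) _ _)

*-distribˡ-∑ : ∀ x n g → x * ∑ n g ≡ ∑ n (λ k → x * g k)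
*-distribˡ-∑ x zero    g = ℤₚ.*-zeroʳ x
*-distribˡ-∑ x (suc n) g =
  trans (ℤₚ.*-distribˡ-+ x (g 0) _) (cong (_+_ (x * g 0)) (*-distribˡ-∑ x n (g ∘ suc)))

infixl 6 _⊕_
infix  8 ⊝_
infixr 7 _·_
infix  4 _≗[≤_]_

_⊕_ : PS → PS → PS
(a ⊕ b) n = a n + b n

⊝_ : PS → PS
(⊝ a) n = - a n

𝟘 : PS
𝟘 _ = 0ℤ

_·_ : ℤ → PS → PS
(x · a) n = x * a n

cst : ℤ → PS
cst x zero    = x
cst x (suc n) = 0ℤ

one≗cst1 : one ≗ cst 1ℤ
one≗cst1 zero    = refl
one≗cst1 (suc n) = refl

shift : PS → PS
shift a n = a (suc n)

_≗[≤_]_ : PS → ℕ → PS → Set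
a ≗[≤ n ] b = ∀ k → k ≤ n → a k ≡ b k

⊛-coeff : ∀ a b n → (a ⊛ b) n ≡ ∑ (suc n) (λ k → a k * b (n ∸ k))
⊛-coeff a b n = cong Σℤ (List.map-upTo (λ k → a k * b (n ∸ k)) (suc n))

⊛-coeff-zero : ∀ a b → (a ⊛ b) 0 ≡ a 0 * b 0
⊛-coeff-zero a b = ℤₚ.+-identityʳ (a 0 * b 0)

⊛-coeff-suc : ∀ a b n → (a ⊛ b) (suc n) ≡ a 0 * b (suc n) + (shift a ⊛ b) n
⊛-coeff-suc a b n = trans (⊛-coeff a b (suc n)) (cong (_+_ (a 0 * b (suc n))) (sym (⊛-coeff (shift a) b n)))

⊛-local : ∀ {a a′ b b′} n → a ≗[≤ n ] a′ → b ≗[≤ n ] b′ → (a ⊛ b) n ≡ (a′ ⊛ b′) n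
⊛-local {a} {a′} {b} {b′} n a≗a′ b≗b′ = begin
  (a ⊛ b) n                           ≡⟨ ⊛-coeff a b n ⟩
  ∑ (suc n) (λ k → a k * b (n ∸ k))   ≡⟨ ∑-cong (suc n) _ _ termwise ⟩
  ∑ (suc n) (λ k → a′ k * b′ (n ∸ k)) ≡⟨ ⊛-coeff a′ b′ n ⟨
  (a′ ⊛ b′) n                         ∎
  where
  open ≡-Reasoning
  termwise : ∀ k → k < suc n → a k * b (n ∸ k) ≡ a′ k * b′ (n ∸ k)
  termwise k k<1+n = cong₂ _*_ (a≗a′ k (ℕₚ.≤-pred k<1+n)) (b≗b′ (n ∸ k) (ℕₚ.m∸n≤m n k))

⊛-cong : ∀ {a a′ b b′} → a ≗ a′ → b ≗ b′ → a ⊛ b ≗ a′ ⊛ b′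
⊛-cong a≗a′ b≗b′ n = ⊛-local n (λ k _ → a≗a′ k) (λ k _ → b≗b′ k)

⊛-congˡ : ∀ a {b b′} → b ≗ b′ → a ⊛ b ≗ a ⊛ b′
⊛-congˡ a b≗b′ = ⊛-cong {a′ = a} (λ _ → refl) b≗b′

⊛-congʳ : ∀ b {a a′} → a ≗ a′ → a ⊛ b ≗ a′ ⊛ b
⊛-congʳ b a≗a′ = ⊛-cong {b′ = b} a≗a′ (λ _ → refl)

⊛-distribˡ-⊕ : ∀ a b c → a ⊛ (b ⊕ c) ≗ a ⊛ b ⊕ a ⊛ c
⊛-distribˡ-⊕ a b c n = begin
  (a ⊛ (b ⊕ c)) n                                       ≡⟨ ⊛-coeff a (b ⊕ c) n ⟩
  ∑ (suc n) (λ k → a k * (b (n ∸ k) + c (n ∸ k)))       ≡⟨ ∑-cong (suc n) _ _ (λ k _ → distrib k) ⟩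
  ∑ (suc n) (λ k → ab k + ac k)                         ≡⟨ ∑-+ (suc n) ab ac ⟩
  ∑ (suc n) ab + ∑ (suc n) ac                           ≡⟨ cong₂ _+_ (⊛-coeff a b n) (⊛-coeff a c n) ⟨
  (a ⊛ b ⊕ a ⊛ c) n                                     ∎
  where
  open ≡-Reasoning
  ab ac : ℕ → ℤ
  ab k = a k * b (n ∸ k)
  ac k = a k * c (n ∸ k)
  distrib : ∀ k → a k * (b (n ∸ k) + c (n ∸ k)) ≡ a k * b (n ∸ k) + a k * c (n ∸ k)
  distrib k = ℤₚ.*-distribˡ-+ (a k) (b (n ∸ k)) (c (n ∸ k))

·-⊛ : ∀ x a b → (x · a) ⊛ b ≗ x · (a ⊛ b)
·-⊛ x a b n = begin
  ((x · a) ⊛ b) n                         ≡⟨ ⊛-coeff (x · a) b n ⟩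
  ∑ (suc n) (λ k → x * a k * b (n ∸ k))   ≡⟨ ∑-cong (suc n) _ _ (λ k _ → assoc k) ⟩
  ∑ (suc n) (λ k → x * (a k * b (n ∸ k))) ≡⟨ *-distribˡ-∑ x (suc n) (λ k → a k * b (n ∸ k)) ⟨
  x * ∑ (suc n) (λ k → a k * b (n ∸ k))   ≡⟨ cong (x *_) (⊛-coeff a b n) ⟨
  (x · (a ⊛ b)) n                         ∎
  where
  open ≡-Reasoning
  assoc : ∀ k → x * a k * b (n ∸ k) ≡ x * (a k * b (n ∸ k))
  assoc k = ℤₚ.*-assoc x (a k) (b (n ∸ k))

-- The ring of power series

⊛-comm : ∀ a b → a ⊛ b ≗ b ⊛ a
⊛-comm a b zero = trans (⊛-coeff-zero a b) (trans (ℤₚ.*-comm (a 0) (b 0)) (sym (⊛-coeff-zero b a)))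
⊛-comm a b (suc zero) = begin
  (a ⊛ b) 1                   ≡⟨ ⊛-coeff-suc a b 0 ⟩
  a 0 * b 1 + (shift a ⊛ b) 0 ≡⟨ cong (_+_ (a 0 * b 1)) (⊛-coeff-zero (shift a) b) ⟩
  a 0 * b 1 + a 1 * b 0       ≡⟨ swap (a 0) (b 1) (a 1) (b 0) ⟩
  b 0 * a 1 + b 1 * a 0       ≡⟨ cong (_+_ (b 0 * a 1)) (⊛-coeff-zero (shift b) a) ⟨
  b 0 * a 1 + (shift b ⊛ a) 0 ≡⟨ ⊛-coeff-suc b a 0 ⟨
  (b ⊛ a) 1                   ∎
  where
  open ≡-Reasoning
  swap : ∀ p q r s → p * q + r * s ≡ s * r + q * p
  swap = solve-∀
⊛-comm a b (suc (suc n)) = begin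
  (a ⊛ b) (2 ℕ.+ n)                  ≡⟨ ⊛-coeff-suc a b (suc n) ⟩
  x + (shift a ⊛ b) (suc n)          ≡⟨ cong (_+_ x) (⊛-comm (shift a) b (suc n)) ⟩
  x + (b ⊛ shift a) (suc n)          ≡⟨ cong (_+_ x) (⊛-coeff-suc b (shift a) n) ⟩
  x + (y + (shift b ⊛ shift a) n)    ≡⟨ cong (λ z → x + (y + z)) (⊛-comm (shift b) (shift a) n) ⟩
  x + (y + (shift a ⊛ shift b) n)    ≡⟨ x+[y+z]≡y+[x+z] x y _ ⟩
  y + (x + (shift a ⊛ shift b) n)    ≡⟨ cong (_+_ y) (⊛-coeff-suc a (shift b) n) ⟨
  y + (a ⊛ shift b) (suc n)          ≡⟨ cong (_+_ y) (⊛-comm a (shift b) (suc n)) ⟩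
  y + (shift b ⊛ a) (suc n)          ≡⟨ ⊛-coeff-suc b a (suc n) ⟨
  (b ⊛ a) (2 ℕ.+ n)                  ∎
  where
  open ≡-Reasoning
  x = a 0 * b (2 ℕ.+ n)
  y = b 0 * a (2 ℕ.+ n)

𝟘-⊛ : ∀ a → 𝟘 ⊛ a ≗ 𝟘
𝟘-⊛ a n = trans (·-⊛ 0ℤ 𝟘 a n) (ℤₚ.*-zeroˡ ((𝟘 ⊛ a) n))

⊛-identityˡ : ∀ a → one ⊛ a ≗ a
⊛-identityˡ a zero    = trans (⊛-coeff-zero one a) (ℤₚ.*-identityˡ (a 0))
⊛-identityˡ a (suc n) = begin
  (one ⊛ a) (suc n)                  ≡⟨ ⊛-coeff-suc one a n ⟩
  1ℤ * a (suc n) + (shift one ⊛ a) n ≡⟨ cong₂ _+_ (ℤₚ.*-identityˡ (a (suc n))) (𝟘-⊛ a n) ⟩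
  a (suc n) + 0ℤ                     ≡⟨ ℤₚ.+-identityʳ (a (suc n)) ⟩
  a (suc n)                          ∎
  where open ≡-Reasoning

⊛-identityʳ : ∀ a → a ⊛ one ≗ a
⊛-identityʳ a n = trans (⊛-comm a one n) (⊛-identityˡ a n)

cst-⊛ : ∀ x a → cst x ⊛ a ≗ x · a
cst-⊛ x a n = begin
  (cst x ⊛ a) n        ≡⟨ ⊛-congʳ a cst≗·one n ⟩
  ((x · one) ⊛ a) n    ≡⟨ ·-⊛ x one a n ⟩
  x * (one ⊛ a) n      ≡⟨ cong (x *_) (⊛-identityˡ a n) ⟩
  x * a n              ∎
  where
  open ≡-Reasoning
  cst≗·one : cst x ≗ x · one
  cst≗·one zero    = sym (ℤₚ.*-identityʳ x)
  cst≗·one (suc n) = sym (ℤₚ.*-zeroʳ x)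

⊛-distribʳ-⊕ : ∀ a b c → (b ⊕ c) ⊛ a ≗ b ⊛ a ⊕ c ⊛ a
⊛-distribʳ-⊕ a b c n = begin
  ((b ⊕ c) ⊛ a) n     ≡⟨ ⊛-comm (b ⊕ c) a n ⟩
  (a ⊛ (b ⊕ c)) n     ≡⟨ ⊛-distribˡ-⊕ a b c n ⟩
  (a ⊛ b ⊕ a ⊛ c) n   ≡⟨ cong₂ _+_ (⊛-comm a b n) (⊛-comm a c n) ⟩
  (b ⊛ a ⊕ c ⊛ a) n   ∎
  where open ≡-Reasoning

⊛-assoc : ∀ a b c → (a ⊛ b) ⊛ c ≗ a ⊛ (b ⊛ c)
⊛-assoc a b c zero = begin
  ((a ⊛ b) ⊛ c) 0     ≡⟨ ⊛-coeff-zero (a ⊛ b) c ⟩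
  (a ⊛ b) 0 * c 0     ≡⟨ cong (_* c 0) (⊛-coeff-zero a b) ⟩
  a 0 * b 0 * c 0     ≡⟨ ℤₚ.*-assoc (a 0) (b 0) (c 0) ⟩
  a 0 * (b 0 * c 0)   ≡⟨ cong (a 0 *_) (⊛-coeff-zero b c) ⟨
  a 0 * (b ⊛ c) 0     ≡⟨ ⊛-coeff-zero a (b ⊛ c) ⟨
  (a ⊛ (b ⊛ c)) 0     ∎
  where open ≡-Reasoning
⊛-assoc a b c (suc n) = begin
  ((a ⊛ b) ⊛ c) (suc n)                                     ≡⟨ ⊛-coeff-suc (a ⊛ b) c n ⟩
  (a ⊛ b) 0 * c (suc n) + (shift (a ⊛ b) ⊛ c) n             ≡⟨ cong₂ _+_ (cong (_* c (suc n)) (⊛-coeff-zero a b)) tail ⟩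
  a 0 * b 0 * c (suc n) + (a 0 * (shift b ⊛ c) n + r)       ≡⟨ regroup (a 0) (b 0) (c (suc n)) _ r ⟩
  a 0 * (b 0 * c (suc n) + (shift b ⊛ c) n) + r             ≡⟨ cong (λ z → a 0 * z + r) (⊛-coeff-suc b c n) ⟨
  a 0 * (b ⊛ c) (suc n) + r                                 ≡⟨ ⊛-coeff-suc a (b ⊛ c) n ⟨
  (a ⊛ (b ⊛ c)) (suc n)                                     ∎
  where
  open ≡-Reasoning
  r = (shift a ⊛ (b ⊛ c)) n
  regroup : ∀ p q r s t → p * q * r + (p * s + t) ≡ p * (q * r + s) + t
  regroup = solve-∀
  tail : (shift (a ⊛ b) ⊛ c) n ≡ a 0 * (shift b ⊛ c) n + r
  tail = begin
    (shift (a ⊛ b) ⊛ c) n                             ≡⟨ ⊛-congʳ c (⊛-coeff-suc a b) n ⟩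
    ((a 0 · shift b ⊕ shift a ⊛ b) ⊛ c) n             ≡⟨ ⊛-distribʳ-⊕ c (a 0 · shift b) (shift a ⊛ b) n ⟩
    ((a 0 · shift b) ⊛ c) n + ((shift a ⊛ b) ⊛ c) n
      ≡⟨ cong₂ _+_ (·-⊛ (a 0) (shift b) c n) (⊛-assoc (shift a) b c n) ⟩
    a 0 * (shift b ⊛ c) n + r                         ∎

ps-isCommutativeRing : IsCommutativeRing _≗_ _⊕_ _⊛_ ⊝_ 𝟘 one
ps-isCommutativeRing = record
  { isRing = record
    { +-isAbelianGroup = Pointwise.isAbelianGroup ℤₚ.+-0-isAbelianGroup
    ; *-cong           = ⊛-cong
    ; *-assoc          = ⊛-assoc
    ; *-identity       = ⊛-identityˡ , ⊛-identityʳ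
    ; distrib          = ⊛-distribˡ-⊕ , ⊛-distribʳ-⊕
    }
  ; *-comm = ⊛-comm
  }

ps-commutativeRing : CommutativeRing 0ℓ 0ℓ
ps-commutativeRing = record { isCommutativeRing = ps-isCommutativeRing }

module ≗-Reasoning = SetoidReasoning (CommutativeRing.setoid ps-commutativeRing)

open CommSemigroupProperties (CommutativeRing.*-commutativeSemigroup ps-commutativeRing)
  using ()
  renaming (interchange to ⊛-interchange; x∙yz≈y∙xz to x⊛[y⊛z]≗y⊛[x⊛z]; x∙yz≈yx∙z to x⊛[y⊛z]≗[y⊛x]⊛z)

cst-morphism : ℤ.+-*-rawRing -Raw-AlmostCommutative⟶ fromCommutativeRing ps-commutativeRing
cst-morphism = record
  { ⟦_⟧    = cst
  ; +-homo = λ x y → λ { zero → refl ; (suc n) → refl }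
  ; *-homo = λ x y n → trans (cst-* x y n) (sym (cst-⊛ x (cst y) n))
  ; -‿homo = λ x → λ { zero → refl ; (suc n) → refl }
  ; 0-homo = λ { zero → refl ; (suc n) → refl }
  ; 1-homo = λ n → sym (one≗cst1 n)
  }
  where
  cst-* : ∀ x y → cst (x * y) ≗ x · cst y
  cst-* x y zero    = refl
  cst-* x y (suc n) = sym (ℤₚ.*-zeroʳ x)

cst-≟ : ∀ x y → Maybe (cst x ≗ cst y)
cst-≟ x y with x ℤ.≟ y
... | yes refl = just (λ _ → refl)
... | no _     = nothing

open Algebra.Solver.Ring ℤ.+-*-rawRing (fromCommutativeRing ps-commutativeRing) cst-morphism cst-≟
  using (solve; _:=_; con; _:+_; _:-_; _:*_)

-- Monomials, partial products and coefficientwise limits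

δ-≢ : ∀ {K n} → K ≢ n → δ K n ≡ 0ℤ
δ-≢ {K} {n} K≢n with K ℕ.≟ n
... | yes K≡n = contradiction K≡n K≢n
... | no _    = refl

δ-diag : ∀ K → δ K K ≡ 1ℤ
δ-diag K with K ℕ.≟ K
... | yes _  = refl
... | no K≢K = contradiction refl K≢K

δ-suc : ∀ K n → δ (suc K) (suc n) ≡ δ K n
δ-suc K n with K ℕ.≟ n
... | yes refl = δ-diag (suc K)
... | no K≢n   = δ-≢ (K≢n ∘ ℕₚ.suc-injective)

δ-suc-⊛ : ∀ K a n → (δ (suc K) ⊛ a) (suc n) ≡ (δ K ⊛ a) n
δ-suc-⊛ K a n = begin
  (δ (suc K) ⊛ a) (suc n)                    ≡⟨ ⊛-coeff-suc (δ (suc K)) a n ⟩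
  0ℤ * a (suc n) + (shift (δ (suc K)) ⊛ a) n ≡⟨ ℤₚ.+-identityˡ _ ⟩
  (shift (δ (suc K)) ⊛ a) n                  ≡⟨ ⊛-congʳ a (δ-suc K) n ⟩
  (δ K ⊛ a) n                                ∎
  where open ≡-Reasoning

δ-⊛ : ∀ K L → δ K ⊛ δ L ≗ δ (K ℕ.+ L)
δ-⊛ zero    L         = ⊛-identityˡ (δ L)
δ-⊛ (suc K) L zero    = ⊛-coeff-zero (δ (suc K)) (δ L)
δ-⊛ (suc K) L (suc n) = trans (δ-suc-⊛ K (δ L) n) (trans (δ-⊛ K L n) (sym (δ-suc (K ℕ.+ L) n)))

oneMinusQ≗ : ∀ K → oneMinusQ K ≗ cst 1ℤ ⊕ ⊝ δ K
oneMinusQ≗ K zero    = refl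
oneMinusQ≗ K (suc n) = refl

oneMinusQ-cong : ∀ {K L} → K ≡ L → oneMinusQ K ≗ oneMinusQ L
oneMinusQ-cong K≡L n = cong (λ K → oneMinusQ K n) K≡L

oneMinusQ-below : ∀ {K k} → k < K → oneMinusQ K k ≡ one k
oneMinusQ-below {K} {k} k<K = trans (cong (λ z → δ 0 k - z) (δ-≢ (ℕₚ.>⇒≢ k<K))) (ℤₚ.+-identityʳ (δ 0 k))

partialProd-step : ∀ j M k → k < j ℕ.* suc M → partialProd j (suc M) k ≡ partialProd j M k
partialProd-step j M k k<K = trans
  (⊛-local {a′ = one} {b′ = partialProd j M} k (λ i i≤k → oneMinusQ-below (ℕₚ.≤-<-trans i≤k k<K)) (λ _ _ → refl))
  (⊛-identityˡ (partialProd j M) k)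

partialProd-stable : ∀ j {M k} → k ≤ M → partialProd (suc j) M k ≡ f (suc j) k
partialProd-stable j k≤M with ℕₚ.m≤n⇒m<n∨m≡n k≤M
... | inj₂ refl = refl
partialProd-stable j {suc M} {k} _ | inj₁ (s≤s k≤M) =
  trans (partialProd-step (suc j) M k (ℕₚ.≤-trans (s≤s k≤M) (ℕₚ.m≤m+n (suc M) (j ℕ.* suc M))))
        (partialProd-stable j k≤M)

partialProd-2*suc : ∀ j M → partialProd j (2 ℕ.* suc M) ≗ partialProd j (suc (suc (2 ℕ.* M)))
partialProd-2*suc j M n = cong (λ k → partialProd j k n) (ℕₚ.*-suc 2 M)

infix 4 _⟶_

_⟶_ : (ℕ → PS) → PS → Set
X ⟶ a = ∀ n → X n ≗[≤ n ] a

⊛-⟶ : ∀ {X Y a b} → X ⟶ a → Y ⟶ b → (λ n → X n ⊛ Y n) ⟶ a ⊛ b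
⊛-⟶ X⟶a Y⟶b n k k≤n =
  ⊛-local k (λ i i≤k → X⟶a n i (ℕₚ.≤-trans i≤k k≤n)) (λ i i≤k → Y⟶b n i (ℕₚ.≤-trans i≤k k≤n))

partialProd-⟶ : ∀ j {M : ℕ → ℕ} → (∀ n → n ≤ M n) → (λ n → partialProd (suc j) (M n)) ⟶ f (suc j)
partialProd-⟶ j n≤M n k k≤n = partialProd-stable j (ℕₚ.≤-trans k≤n (n≤M n))

limit-≗ : ∀ {X Y a b} → X ⟶ a → Y ⟶ b → (∀ n → X n ≗ Y n) → a ≗ b
limit-≗ X⟶a Y⟶b X≗Y n = trans (sym (X⟶a n n ℕₚ.≤-refl)) (trans (X≗Y n n) (Y⟶b n n ℕₚ.≤-refl))

-- Congruences modulo an integer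

infix 4 _≈_[mod_]

record _≈_[mod_] (a b : PS) (m : ℤ) : Set where
  constructor coeffwise
  field ∣-coeff : ∀ n → m Signed.∣ a n - b n

open _≈_[mod_]

≗⇒≈-mod : ∀ {a b} m → a ≗ b → a ≈ b [mod m ]
≗⇒≈-mod {a} {b} m a≗b = coeffwise λ n → Signed.divides 0ℤ (begin
  a n - b n ≡⟨ cong (λ z → z - b n) (a≗b n) ⟩
  b n - b n ≡⟨ ℤₚ.+-inverseʳ (b n) ⟩
  0ℤ        ≡⟨ ℤₚ.*-zeroˡ m ⟨
  0ℤ * m    ∎)
  where open ≡-Reasoning

≈-mod-refl : ∀ {a m} → a ≈ a [mod m ]
≈-mod-refl {a} {m} = ≗⇒≈-mod {a} m (λ _ → refl)

≈-mod-sym : ∀ {a b m} → a ≈ b [mod m ] → b ≈ a [mod m ]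
≈-mod-sym {a} {b} {m} a≈b = coeffwise λ n →
  subst (m Signed.∣_) (flip (a n) (b n)) (Signed.∣m⇒∣-m (∣-coeff a≈b n))
  where
  flip : ∀ x y → - (x - y) ≡ y - x
  flip = solve-∀

≈-mod-trans : ∀ {a b c m} → a ≈ b [mod m ] → b ≈ c [mod m ] → a ≈ c [mod m ]
≈-mod-trans {a} {b} {c} {m} a≈b b≈c = coeffwise λ n →
  subst (m Signed.∣_) (telescope (a n) (b n) (c n)) (Signed.∣m∣n⇒∣m+n (∣-coeff a≈b n) (∣-coeff b≈c n))
  where
  telescope : ∀ x y z → x - y + (y - z) ≡ x - z
  telescope = solve-∀

≈-mod-setoid : ℤ → Setoid 0ℓ 0ℓ
≈-mod-setoid m = record
  { Carrier       = PS
  ; _≈_           = λ a b → a ≈ b [mod m ]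
  ; isEquivalence = record { refl = ≈-mod-refl ; sym = ≈-mod-sym ; trans = ≈-mod-trans }
  }

module ≈-mod-Reasoning (m : ℤ) = SetoidReasoning (≈-mod-setoid m)

≈-mod-weaken : ∀ {a b k m} → k Signed.∣ m → a ≈ b [mod m ] → a ≈ b [mod k ]
≈-mod-weaken k∣m a≈b = coeffwise λ n → Signed.∣-trans k∣m (∣-coeff a≈b n)

≈-mod⇒multiple : ∀ {a b m} → a ≈ b [mod m ] → Σ PS λ r → a ≗ b ⊕ cst m ⊛ r
≈-mod⇒multiple {a} {b} {m} a≈b = q , a≗b+mq
  where
  q : PS
  q n = Signed.quotient (∣-coeff a≈b n)
  a≗b+mq : a ≗ b ⊕ cst m ⊛ q
  a≗b+mq n = begin
    a n                 ≡⟨ split (a n) (b n) ⟩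
    b n + (a n - b n)   ≡⟨ cong (_+_ (b n)) (Signed._∣_.equality (∣-coeff a≈b n)) ⟩
    b n + q n * m       ≡⟨ cong (_+_ (b n)) (ℤₚ.*-comm (q n) m) ⟩
    b n + m * q n       ≡⟨ cong (_+_ (b n)) (cst-⊛ m q n) ⟨
    (b ⊕ cst m ⊛ q) n   ∎
    where
    open ≡-Reasoning
    split : ∀ x y → x ≡ y + (x - y)
    split = solve-∀

multiple⇒≈-mod : ∀ {a b} m r → a ≗ b ⊕ cst m ⊛ r → a ≈ b [mod m ]
multiple⇒≈-mod {a} {b} m r a≗b+mr = coeffwise λ n → Signed.divides (r n) (begin
  a n - b n                 ≡⟨ cong (λ z → z - b n) (a≗b+mr n) ⟩
  b n + (cst m ⊛ r) n - b n ≡⟨ cong (λ z → b n + z - b n) (cst-⊛ m r n) ⟩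
  b n + m * r n - b n       ≡⟨ cancel (b n) (m * r n) ⟩
  m * r n                   ≡⟨ ℤₚ.*-comm m (r n) ⟩
  r n * m                   ∎)
  where
  open ≡-Reasoning
  cancel : ∀ x y → x + y - x ≡ y
  cancel = solve-∀

⊛-cong-mod : ∀ {a a′ b b′ m} → a ≈ a′ [mod m ] → b ≈ b′ [mod m ] → a ⊛ b ≈ a′ ⊛ b′ [mod m ]
⊛-cong-mod {a′ = a′} {b′ = b′} {m} a≈a′ b≈b′ with ≈-mod⇒multiple a≈a′ | ≈-mod⇒multiple b≈b′
... | r , a≗a′+mr | s , b≗b′+ms = multiple⇒≈-mod m (r ⊛ b′ ⊕ a′ ⊛ s ⊕ cst m ⊛ (r ⊛ s)) (λ n →
  trans (⊛-cong a≗a′+mr b≗b′+ms n) (expand a′ b′ (cst m) r s n))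
  where
  expand : ∀ a b m r s → (a ⊕ m ⊛ r) ⊛ (b ⊕ m ⊛ s) ≗ a ⊛ b ⊕ m ⊛ (r ⊛ b ⊕ a ⊛ s ⊕ m ⊛ (r ⊛ s))
  expand = solve 5 (λ a b m r s → (a :+ m :* r) :* (b :+ m :* s) := a :* b :+ m :* (r :* b :+ a :* s :+ m :* (r :* s)))
                   (λ _ → refl)

⊛-congˡ-mod : ∀ a {b b′ m} → b ≈ b′ [mod m ] → a ⊛ b ≈ a ⊛ b′ [mod m ]
⊛-congˡ-mod a = ⊛-cong-mod (≈-mod-refl {a})

⊛-congʳ-mod : ∀ b {a a′ m} → a ≈ a′ [mod m ] → a ⊛ b ≈ a′ ⊛ b [mod m ]
⊛-congʳ-mod b a≈a′ = ⊛-cong-mod a≈a′ (≈-mod-refl {b})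

powN-cong-mod : ∀ {a b m} k → a ≈ b [mod m ] → powN a k ≈ powN b k [mod m ]
powN-cong-mod zero    a≈b = ≈-mod-refl
powN-cong-mod (suc k) a≈b = ⊛-cong-mod a≈b (powN-cong-mod k a≈b)

square-cong-mod-2 : ∀ {a b} → a ≈ b [mod + 2 ] → a ⊛ a ≈ b ⊛ b [mod + 4 ]
square-cong-mod-2 {b = b} a≈b with ≈-mod⇒multiple a≈b
... | r , a≗b+2r = multiple⇒≈-mod (+ 4) (b ⊛ r ⊕ r ⊛ r) (λ n → trans (⊛-cong a≗b+2r a≗b+2r n) (expand b r n))
  where
  expand : ∀ b r → (b ⊕ cst (+ 2) ⊛ r) ⊛ (b ⊕ cst (+ 2) ⊛ r) ≗ b ⊛ b ⊕ cst (+ 4) ⊛ (b ⊛ r ⊕ r ⊛ r)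
  expand = solve 2 (λ b r → (b :+ con (+ 2) :* r) :* (b :+ con (+ 2) :* r) := b :* b :+ con (+ 4) :* (b :* r :+ r :* r))
                   (λ _ → refl)

limit-≈-mod : ∀ {X Y a b m} → X ⟶ a → Y ⟶ b → (∀ n → X n ≈ Y n [mod m ]) → a ≈ b [mod m ]
limit-≈-mod {m = m} X⟶a Y⟶b X≈Y = coeffwise λ n →
  subst₂ (λ x y → m Signed.∣ x - y) (X⟶a n n ℕₚ.≤-refl) (Y⟶b n n ℕₚ.≤-refl) (∣-coeff (X≈Y n) n)

-- The substitution q ↦ c q

rescale : ℤ → PS → PS
rescale c a n = c ^ n * a n

infix 10 _[-q]

_[-q] : PS → PS
a [-q] = rescale (- 1ℤ) a

rescale-cong : ∀ c {a b} → a ≗ b → rescale c a ≗ rescale c b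
rescale-cong c a≗b n = cong (c ^ n *_) (a≗b n)

rescale-⟶ : ∀ c {X a} → X ⟶ a → (λ n → rescale c (X n)) ⟶ rescale c a
rescale-⟶ c X⟶a n k k≤n = cong (c ^ k *_) (X⟶a n k k≤n)

rescale-coeff-zero : ∀ c a → rescale c a 0 ≡ a 0
rescale-coeff-zero c a = ℤₚ.*-identityˡ (a 0)

rescale-⊛ : ∀ c a b → rescale c (a ⊛ b) ≗ rescale c a ⊛ rescale c b
rescale-⊛ c a b n = begin
  c ^ n * (a ⊛ b) n                                          ≡⟨ cong (c ^ n *_) (⊛-coeff a b n) ⟩
  c ^ n * ∑ (suc n) (λ k → a k * b (n ∸ k))                  ≡⟨ *-distribˡ-∑ (c ^ n) (suc n) (λ k → a k * b (n ∸ k)) ⟩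
  ∑ (suc n) (λ k → c ^ n * (a k * b (n ∸ k)))                ≡⟨ ∑-cong (suc n) _ _ termwise ⟩
  ∑ (suc n) (λ k → c ^ k * a k * (c ^ (n ∸ k) * b (n ∸ k)))  ≡⟨ ⊛-coeff (rescale c a) (rescale c b) n ⟨
  (rescale c a ⊛ rescale c b) n                              ∎
  where
  open ≡-Reasoning
  termwise : ∀ k → k < suc n → c ^ n * (a k * b (n ∸ k)) ≡ c ^ k * a k * (c ^ (n ∸ k) * b (n ∸ k))
  termwise k k<1+n = begin
    c ^ n * (a k * b (n ∸ k))
      ≡⟨ cong (λ i → c ^ i * (a k * b (n ∸ k))) (ℕₚ.m+[n∸m]≡n (ℕₚ.≤-pred k<1+n)) ⟨
    c ^ (k ℕ.+ (n ∸ k)) * (a k * b (n ∸ k))   ≡⟨ cong (_* (a k * b (n ∸ k))) (ℤₚ.^-distribˡ-+-* c k (n ∸ k)) ⟩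
    c ^ k * c ^ (n ∸ k) * (a k * b (n ∸ k))   ≡⟨ *-interchange (c ^ k) (c ^ (n ∸ k)) (a k) (b (n ∸ k)) ⟩
    c ^ k * a k * (c ^ (n ∸ k) * b (n ∸ k))   ∎

rescale-one : ∀ c → rescale c one ≗ one
rescale-one c zero    = refl
rescale-one c (suc n) = ℤₚ.*-zeroʳ (c ^ suc n)

rescale-powN : ∀ c a k → rescale c (powN a k) ≗ powN (rescale c a) k
rescale-powN c a zero    = rescale-one c
rescale-powN c a (suc k) n =
  trans (rescale-⊛ c a (powN a k) n) (⊛-congˡ (rescale c a) (rescale-powN c a k) n)

^-*-δ : ∀ c K n → c ^ n * δ K n ≡ c ^ K * δ K n
^-*-δ c K n with K ℕ.≟ n
... | yes refl = refl
... | no _     = trans (ℤₚ.*-zeroʳ (c ^ n)) (sym (ℤₚ.*-zeroʳ (c ^ K)))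

rescale-oneMinusQ : ∀ c K n → rescale c (oneMinusQ K) n ≡ δ 0 n - c ^ K * δ K n
rescale-oneMinusQ c K n = begin
  c ^ n * (δ 0 n - δ K n)           ≡⟨ ℤₚ.*-distribˡ-+ (c ^ n) (δ 0 n) (- δ K n) ⟩
  c ^ n * δ 0 n + c ^ n * - δ K n   ≡⟨ cong₂ _+_ (trans (^-*-δ c 0 n) (ℤₚ.*-identityˡ (δ 0 n)))
                                                 (trans (sym (ℤₚ.neg-distribʳ-* (c ^ n) (δ K n))) (cong -_ (^-*-δ c K n))) ⟩
  δ 0 n - c ^ K * δ K n             ∎
  where open ≡-Reasoning

rescale-oneMinusQ-fixed : ∀ c K → c ^ K ≡ 1ℤ → rescale c (oneMinusQ K) ≗ oneMinusQ K
rescale-oneMinusQ-fixed c K cᴷ≡1 n =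
  trans (rescale-oneMinusQ c K n) (cong (λ x → δ 0 n - x) (trans (cong (_* δ K n) cᴷ≡1) (ℤₚ.*-identityˡ (δ K n))))

c-1∣c^n-1 : ∀ c n → (c - 1ℤ) Signed.∣ c ^ n - 1ℤ
c-1∣c^n-1 c zero    = Signed.divides 0ℤ (sym (ℤₚ.*-zeroˡ (c - 1ℤ)))
c-1∣c^n-1 c (suc n) = subst ((c - 1ℤ) Signed.∣_) (telescope c (c ^ n))
  (Signed.∣m∣n⇒∣m+n (Signed.∣n⇒∣m*n c (c-1∣c^n-1 c n)) Signed.∣-refl)
  where
  telescope : ∀ c x → c * (x - 1ℤ) + (c - 1ℤ) ≡ c * x - 1ℤ
  telescope = solve-∀

rescale-≈-mod : ∀ c a → rescale c a ≈ a [mod c - 1ℤ ]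
rescale-≈-mod c a = coeffwise λ n →
  subst ((c - 1ℤ) Signed.∣_) (factor (c ^ n) (a n)) (Signed.∣m⇒∣m*n (a n) (c-1∣c^n-1 c n))
  where
  factor : ∀ y x → (y - 1ℤ) * x ≡ y * x - x
  factor = solve-∀

[-q]≈-mod-2 : ∀ a → a [-q] ≈ a [mod + 2 ]
[-q]≈-mod-2 a = ≈-mod-weaken Signed.∣m∣∣m (rescale-≈-mod (- 1ℤ) a)

[-q]-square : ∀ a → a [-q] ⊛ a [-q] ≈ a ⊛ a [mod + 4 ]
[-q]-square a = square-cong-mod-2 ([-q]≈-mod-2 a)

-1^even : ∀ {n} → 2 ∣ₙ n → (- 1ℤ) ^ n ≡ 1ℤ
-1^even (divides q refl) = begin
  (- 1ℤ) ^ (q ℕ.* 2)   ≡⟨ cong ((- 1ℤ) ^_) (ℕₚ.*-comm q 2) ⟩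
  (- 1ℤ) ^ (2 ℕ.* q)   ≡⟨ ℤₚ.^-*-assoc (- 1ℤ) 2 q ⟨
  1ℤ ^ q               ≡⟨ ℤₚ.^-zeroˡ q ⟩
  1ℤ                   ∎
  where open ≡-Reasoning

-1^odd : ∀ {n} → 2 ∣ₙ n → (- 1ℤ) ^ suc n ≡ - 1ℤ
-1^odd 2∣n = trans (cong (- 1ℤ *_) (-1^even 2∣n)) (ℤₚ.*-identityʳ (- 1ℤ))

oneMinusQ[-q]-odd : ∀ K → (- 1ℤ) ^ K ≡ - 1ℤ → oneMinusQ K [-q] ≗ cst 1ℤ ⊕ δ K
oneMinusQ[-q]-odd K [-1]ᴷ≡-1 n = begin
  (oneMinusQ K [-q]) n          ≡⟨ rescale-oneMinusQ (- 1ℤ) K n ⟩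
  δ 0 n - (- 1ℤ) ^ K * δ K n    ≡⟨ cong (λ z → δ 0 n - z * δ K n) [-1]ᴷ≡-1 ⟩
  δ 0 n - - 1ℤ * δ K n          ≡⟨ minus-minus (δ 0 n) (δ K n) ⟩
  δ 0 n + δ K n                 ≡⟨ cong (_+ δ K n) (one≗cst1 n) ⟩
  cst 1ℤ n + δ K n              ∎
  where
  open ≡-Reasoning
  minus-minus : ∀ x y → x - - 1ℤ * y ≡ x + y
  minus-minus = solve-∀

oneMinusQ[-q]⊛oneMinusQ-odd : ∀ K → (- 1ℤ) ^ K ≡ - 1ℤ → oneMinusQ K [-q] ⊛ oneMinusQ K ≗ oneMinusQ (K ℕ.+ K)
oneMinusQ[-q]⊛oneMinusQ-odd K [-1]ᴷ≡-1 = begin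
  oneMinusQ K [-q] ⊛ oneMinusQ K    ≈⟨ ⊛-cong (oneMinusQ[-q]-odd K [-1]ᴷ≡-1) (oneMinusQ≗ K) ⟩
  (cst 1ℤ ⊕ y) ⊛ (cst 1ℤ ⊕ ⊝ y)    ≈⟨ difference-of-squares y ⟩
  cst 1ℤ ⊕ ⊝ (y ⊛ y)               ≈⟨ (λ n → cong (λ z → cst 1ℤ n - z) (δ-⊛ K K n)) ⟩
  cst 1ℤ ⊕ ⊝ δ (K ℕ.+ K)           ≈⟨ oneMinusQ≗ (K ℕ.+ K) ⟨
  oneMinusQ (K ℕ.+ K)               ∎
  where
  open ≗-Reasoning
  y = δ K
  difference-of-squares : ∀ y → (cst 1ℤ ⊕ y) ⊛ (cst 1ℤ ⊕ ⊝ y) ≗ cst 1ℤ ⊕ ⊝ (y ⊛ y)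
  difference-of-squares = solve 1 (λ y → (con 1ℤ :+ y) :* (con 1ℤ :- y) := con 1ℤ :- y :* y) (λ _ → refl)

-- Inverses and integer powers

zipWith-applyUpTo : ∀ {A B C : Set} (_∙_ : A → B → C) g h n →
                    zipWith _∙_ (applyUpTo g n) (applyUpTo h n) ≡ applyUpTo (λ i → g i ∙ h i) n
zipWith-applyUpTo _∙_ g h zero    = refl
zipWith-applyUpTo _∙_ g h (suc n) = cong (g 0 ∙ h 0 ∷_) (zipWith-applyUpTo _∙_ (g ∘ suc) (h ∘ suc) n)

invRev-applyUpTo : ∀ a n → invRev a n ≡ applyUpTo (λ i → inv a (n ∸ i)) (suc n)
invRev-applyUpTo a zero    = refl
invRev-applyUpTo a (suc n) = cong (inv a (suc n) ∷_) (invRev-applyUpTo a n)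

inv-suc : ∀ a n → inv a (suc n) ≡ - (shift a ⊛ inv a) n
inv-suc a n = cong -_ (begin
  Σℤ (zipWith _*_ (map (a ∘ suc) (upTo (suc n))) (invRev a n))
    ≡⟨ cong₂ (λ xs ys → Σℤ (zipWith _*_ xs ys)) (List.map-upTo (a ∘ suc) (suc n)) (invRev-applyUpTo a n) ⟩
  Σℤ (zipWith _*_ (applyUpTo (a ∘ suc) (suc n)) (applyUpTo (λ i → inv a (n ∸ i)) (suc n)))
    ≡⟨ cong Σℤ (zipWith-applyUpTo _*_ (a ∘ suc) (λ i → inv a (n ∸ i)) (suc n)) ⟩
  ∑ (suc n) (λ i → a (suc i) * inv a (n ∸ i))
    ≡⟨ ⊛-coeff (shift a) (inv a) n ⟨
  (shift a ⊛ inv a) n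
    ∎)
  where open ≡-Reasoning

⊛-inv : ∀ a → a 0 ≡ 1ℤ → a ⊛ inv a ≗ one
⊛-inv a a₀≡1 zero    = trans (⊛-coeff-zero a (inv a)) (trans (ℤₚ.*-identityʳ (a 0)) a₀≡1)
⊛-inv a a₀≡1 (suc n) = begin
  (a ⊛ inv a) (suc n)                              ≡⟨ ⊛-coeff-suc a (inv a) n ⟩
  a 0 * inv a (suc n) + (shift a ⊛ inv a) n        ≡⟨ cong₂ (λ x y → x * y + (shift a ⊛ inv a) n) a₀≡1 (inv-suc a n) ⟩
  1ℤ * - (shift a ⊛ inv a) n + (shift a ⊛ inv a) n ≡⟨ cancel ((shift a ⊛ inv a) n) ⟩
  0ℤ                                               ∎
  where
  open ≡-Reasoning
  cancel : ∀ x → 1ℤ * - x + x ≡ 0ℤ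
  cancel = solve-∀

inverse-unique : ∀ a {b c} → a ⊛ b ≗ one → a ⊛ c ≗ one → b ≗ c
inverse-unique a {b} {c} ab≗1 ac≗1 = begin
  b             ≈⟨ ⊛-identityʳ b ⟨
  b ⊛ one       ≈⟨ ⊛-congˡ b ac≗1 ⟨
  b ⊛ (a ⊛ c)   ≈⟨ x⊛[y⊛z]≗[y⊛x]⊛z b a c ⟩
  (a ⊛ b) ⊛ c   ≈⟨ ⊛-congʳ c ab≗1 ⟩
  one ⊛ c       ≈⟨ ⊛-identityˡ c ⟩
  c             ∎
  where open ≗-Reasoning

inv-cong : ∀ {a b} → a 0 ≡ 1ℤ → a ≗ b → inv a ≗ inv b
inv-cong {a} {b} a₀≡1 a≗b =
  inverse-unique b (λ n → trans (⊛-congʳ (inv a) (λ k → sym (a≗b k)) n) (⊛-inv a a₀≡1 n))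
                   (⊛-inv b (trans (sym (a≗b 0)) a₀≡1))

inv-⊛ : ∀ a b → a 0 ≡ 1ℤ → b 0 ≡ 1ℤ → inv (a ⊛ b) ≗ inv a ⊛ inv b
inv-⊛ a b a₀≡1 b₀≡1 = inverse-unique (a ⊛ b) (⊛-inv (a ⊛ b) ab₀≡1) (begin
  (a ⊛ b) ⊛ (inv a ⊛ inv b)   ≈⟨ ⊛-interchange a b (inv a) (inv b) ⟩
  (a ⊛ inv a) ⊛ (b ⊛ inv b)   ≈⟨ ⊛-cong (⊛-inv a a₀≡1) (⊛-inv b b₀≡1) ⟩
  one ⊛ one                   ≈⟨ ⊛-identityˡ one ⟩
  one                         ∎)
  where
  open ≗-Reasoning
  ab₀≡1 : (a ⊛ b) 0 ≡ 1ℤ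
  ab₀≡1 = trans (⊛-coeff-zero a b) (cong₂ _*_ a₀≡1 b₀≡1)

rescale-inv : ∀ c a → a 0 ≡ 1ℤ → rescale c (inv a) ≗ inv (rescale c a)
rescale-inv c a a₀≡1 = inverse-unique (rescale c a) (begin
  rescale c a ⊛ rescale c (inv a)   ≈⟨ rescale-⊛ c a (inv a) ⟨
  rescale c (a ⊛ inv a)             ≈⟨ rescale-cong c (⊛-inv a a₀≡1) ⟩
  rescale c one                     ≈⟨ rescale-one c ⟩
  one                               ∎)
  (⊛-inv (rescale c a) (trans (rescale-coeff-zero c a) a₀≡1))
  where open ≗-Reasoning

powN-cong : ∀ {a b} k → a ≗ b → powN a k ≗ powN b k
powN-cong zero    a≗b = λ _ → refl
powN-cong (suc k) a≗b = ⊛-cong a≗b (powN-cong k a≗b)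

powN-⊛ : ∀ a b k → powN (a ⊛ b) k ≗ powN a k ⊛ powN b k
powN-⊛ a b zero    n = sym (⊛-identityˡ one n)
powN-⊛ a b (suc k) = begin
  (a ⊛ b) ⊛ powN (a ⊛ b) k          ≈⟨ ⊛-congˡ (a ⊛ b) (powN-⊛ a b k) ⟩
  (a ⊛ b) ⊛ (powN a k ⊛ powN b k)   ≈⟨ ⊛-interchange a b (powN a k) (powN b k) ⟩
  (a ⊛ powN a k) ⊛ (b ⊛ powN b k)   ∎
  where open ≗-Reasoning

zpow-cong : ∀ {a b} e → a 0 ≡ 1ℤ → a ≗ b → zpow a e ≗ zpow b e
zpow-cong (+ k)    _    a≗b = powN-cong k a≗b
zpow-cong -[1+ k ] a₀≡1 a≗b = powN-cong (suc k) (inv-cong a₀≡1 a≗b)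

zpow-⊛ : ∀ a b e → a 0 ≡ 1ℤ → b 0 ≡ 1ℤ → zpow (a ⊛ b) e ≗ zpow a e ⊛ zpow b e
zpow-⊛ a b (+ k)    _    _    = powN-⊛ a b k
zpow-⊛ a b -[1+ k ] a₀≡1 b₀≡1 n =
  trans (powN-cong (suc k) (inv-⊛ a b a₀≡1 b₀≡1) n) (powN-⊛ (inv a) (inv b) (suc k) n)

rescale-zpow : ∀ c a e → a 0 ≡ 1ℤ → rescale c (zpow a e) ≗ zpow (rescale c a) e
rescale-zpow c a (+ k)    _      = rescale-powN c a k
rescale-zpow c a -[1+ k ] a₀≡1 n =
  trans (rescale-powN c (inv a) (suc k) n) (powN-cong (suc k) (rescale-inv c a a₀≡1) n)

even⊎odd : ∀ n → 2 ∣ₙ n ⊎ Σ ℕ λ q → n ≡ suc (q ℕ.* 2)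
even⊎odd zero          = inj₁ (divides 0 refl)
even⊎odd (suc zero)    = inj₂ (0 , refl)
even⊎odd (suc (suc n)) with even⊎odd n
... | inj₁ (divides q refl) = inj₁ (divides (suc q) refl)
... | inj₂ (q , refl)       = inj₂ (suc q , refl)

module _ {h : PS} {m : ℤ} (h²≈1 : h ⊛ h ≈ one [mod m ]) where
  open ≈-mod-Reasoning m

  powN-even : ∀ q → powN h (q ℕ.* 2) ≈ one [mod m ]
  powN-even zero    = ≈-mod-refl
  powN-even (suc q) = begin
    h ⊛ (h ⊛ powN h (q ℕ.* 2))   ≈⟨ ≗⇒≈-mod m (⊛-assoc h h (powN h (q ℕ.* 2))) ⟨
    (h ⊛ h) ⊛ powN h (q ℕ.* 2)   ≈⟨ ⊛-cong-mod h²≈1 (powN-even q) ⟩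
    one ⊛ one                    ≈⟨ ≗⇒≈-mod m (⊛-identityˡ one) ⟩
    one                          ∎

  powN-odd : ∀ q → powN h (suc (q ℕ.* 2)) ≈ h [mod m ]
  powN-odd q = begin
    h ⊛ powN h (q ℕ.* 2)   ≈⟨ ⊛-congˡ-mod h (powN-even q) ⟩
    h ⊛ one                ≈⟨ ≗⇒≈-mod m (⊛-identityʳ h) ⟩
    h                      ∎

  inv≈self : h 0 ≡ 1ℤ → inv h ≈ h [mod m ]
  inv≈self h₀≡1 = begin
    inv h             ≈⟨ ≗⇒≈-mod m (⊛-identityʳ (inv h)) ⟨
    inv h ⊛ one       ≈⟨ ⊛-congˡ-mod (inv h) h²≈1 ⟨
    inv h ⊛ (h ⊛ h)   ≈⟨ ≗⇒≈-mod m (x⊛[y⊛z]≗[y⊛x]⊛z (inv h) h h) ⟩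
    (h ⊛ inv h) ⊛ h   ≈⟨ ≗⇒≈-mod m (⊛-congʳ h (⊛-inv h h₀≡1)) ⟩
    one ⊛ h           ≈⟨ ≗⇒≈-mod m (⊛-identityˡ h) ⟩
    h                 ∎

  zpow≈powN-∣∣ : h 0 ≡ 1ℤ → ∀ e → zpow h e ≈ powN h ℤ.∣ e ∣ [mod m ]
  zpow≈powN-∣∣ _    (+ k)    = ≈-mod-refl
  zpow≈powN-∣∣ h₀≡1 -[1+ k ] = powN-cong-mod (suc k) (inv≈self h₀≡1)

  zpow-even : h 0 ≡ 1ℤ → ∀ e → + 2 ∣ e → zpow h e ≈ one [mod m ]
  zpow-even h₀≡1 e (divides q ∣e∣≡2q) = begin
    zpow h e           ≈⟨ zpow≈powN-∣∣ h₀≡1 e ⟩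
    powN h ℤ.∣ e ∣     ≡⟨ cong (powN h) ∣e∣≡2q ⟩
    powN h (q ℕ.* 2)   ≈⟨ powN-even q ⟩
    one                ∎

  zpow-odd : h 0 ≡ 1ℤ → ∀ e → ¬ (+ 2 ∣ e) → zpow h e ≈ h [mod m ]
  zpow-odd h₀≡1 e e-odd with even⊎odd ℤ.∣ e ∣
  ... | inj₁ e-even         = contradiction e-even e-odd
  ... | inj₂ (q , ∣e∣≡2q+1) = begin
    zpow h e                 ≈⟨ zpow≈powN-∣∣ h₀≡1 e ⟩
    powN h ℤ.∣ e ∣           ≡⟨ cong (powN h) ∣e∣≡2q+1 ⟩
    powN h (suc (q ℕ.* 2))   ≈⟨ powN-odd q ⟩
    h                        ∎

-- The products f_j

rescale-partialProd : ∀ c j → c ^ j ≡ 1ℤ → ∀ M → rescale c (partialProd j M) ≗ partialProd j M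
rescale-partialProd c j cʲ≡1 zero    = rescale-one c
rescale-partialProd c j cʲ≡1 (suc M) n =
  trans (rescale-⊛ c (oneMinusQ K) (partialProd j M) n)
        (⊛-cong (rescale-oneMinusQ-fixed c K cᴷ≡1) (rescale-partialProd c j cʲ≡1 M) n)
  where
  K = j ℕ.* suc M
  cᴷ≡1 : c ^ K ≡ 1ℤ
  cᴷ≡1 = trans (sym (ℤₚ.^-*-assoc c j (suc M))) (trans (cong (_^ suc M) cʲ≡1) (ℤₚ.^-zeroˡ (suc M)))

rescale-f : ∀ c j → c ^ j ≡ 1ℤ → rescale c (f j) ≗ f j
rescale-f c j cʲ≡1 n = rescale-partialProd c j cʲ≡1 n n

oneMinusQ-square : ∀ K → oneMinusQ K ⊛ oneMinusQ K ≈ oneMinusQ (K ℕ.+ K) [mod + 2 ]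
oneMinusQ-square K = multiple⇒≈-mod (+ 2) (y ⊛ y ⊕ ⊝ y) (begin
  oneMinusQ K ⊛ oneMinusQ K                          ≈⟨ ⊛-cong (oneMinusQ≗ K) (oneMinusQ≗ K) ⟩
  (cst 1ℤ ⊕ ⊝ y) ⊛ (cst 1ℤ ⊕ ⊝ y)                    ≈⟨ expand y ⟩
  cst 1ℤ ⊕ ⊝ (y ⊛ y) ⊕ cst (+ 2) ⊛ (y ⊛ y ⊕ ⊝ y)     ≈⟨ (λ n → cong (_+ (cst (+ 2) ⊛ (y ⊛ y ⊕ ⊝ y)) n) (1-y² n)) ⟩
  oneMinusQ (K ℕ.+ K) ⊕ cst (+ 2) ⊛ (y ⊛ y ⊕ ⊝ y)    ∎)
  where
  open ≗-Reasoning
  y = δ K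
  expand : ∀ y → (cst 1ℤ ⊕ ⊝ y) ⊛ (cst 1ℤ ⊕ ⊝ y) ≗ cst 1ℤ ⊕ ⊝ (y ⊛ y) ⊕ cst (+ 2) ⊛ (y ⊛ y ⊕ ⊝ y)
  expand = solve 1 (λ y → (con 1ℤ :- y) :* (con 1ℤ :- y) := con 1ℤ :- y :* y :+ con (+ 2) :* (y :* y :- y))
                   (λ _ → refl)
  1-y² : cst 1ℤ ⊕ ⊝ (y ⊛ y) ≗ oneMinusQ (K ℕ.+ K)
  1-y² n = trans (cong (λ z → cst 1ℤ n - z) (δ-⊛ K K n)) (sym (oneMinusQ≗ (K ℕ.+ K) n))

partialProd-square : ∀ j M → partialProd j M ⊛ partialProd j M ≈ partialProd (2 ℕ.* j) M [mod + 2 ]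
partialProd-square j zero    = ≗⇒≈-mod (+ 2) (⊛-identityˡ one)
partialProd-square j (suc M) = begin
  (F ⊛ P) ⊛ (F ⊛ P)                   ≈⟨ ≗⇒≈-mod (+ 2) (⊛-interchange F P F P) ⟩
  (F ⊛ F) ⊛ (P ⊛ P)                   ≈⟨ ⊛-cong-mod (oneMinusQ-square K) (partialProd-square j M) ⟩
  oneMinusQ (K ℕ.+ K) ⊛ Q             ≈⟨ ≗⇒≈-mod (+ 2) (⊛-congʳ Q (oneMinusQ-cong (double j M))) ⟩
  oneMinusQ (2 ℕ.* j ℕ.* suc M) ⊛ Q   ∎
  where
  open ≈-mod-Reasoning (+ 2)
  K = j ℕ.* suc M
  F = oneMinusQ K
  P = partialProd j M
  Q = partialProd (2 ℕ.* j) M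
  double : ∀ j M → j ℕ.* suc M ℕ.+ j ℕ.* suc M ≡ 2 ℕ.* j ℕ.* suc M
  double = ℕ-Solver.solve-∀

f-square : ∀ j → f (suc j) ⊛ f (suc j) ≈ f (2 ℕ.* suc j) [mod + 2 ]
f-square j = limit-≈-mod (⊛-⟶ (partialProd-⟶ j n≤n) (partialProd-⟶ j n≤n)) (partialProd-⟶ _ n≤n)
                         (partialProd-square (suc j))
  where
  n≤n : ∀ n → n ≤ n
  n≤n _ = ℕₚ.≤-refl

P₁[-q]P₁P₄ : ℕ → PS
P₁[-q]P₁P₄ M = partialProd 1 (2 ℕ.* M) [-q] ⊛ partialProd 1 (2 ℕ.* M) ⊛ partialProd 4 M

P₂³ : ℕ → PS
P₂³ M = partialProd 2 (2 ℕ.* M) ⊛ partialProd 2 M ⊛ partialProd 2 M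

-- From M to M + 1 both sides gain (1 - q^{2M+2})² (1 - q^{4M+4}) (1 - q^{4M+2}); on the left
-- the last factor arises as (1 + q^{2M+1})(1 - q^{2M+1}).
new-factors : ℕ → PS
new-factors M = G ⊛ G ⊛ oneMinusQ (4 ℕ.* suc M) ⊛ oneMinusQ (2 ℕ.* suc (2 ℕ.* M))
  where G = oneMinusQ (2 ℕ.* suc M)

P₁[-q]P₁P₄-step : ∀ M → P₁[-q]P₁P₄ (suc M) ≗ new-factors M ⊛ P₁[-q]P₁P₄ M
P₁[-q]P₁P₄-step M = begin
  P₁[-q]P₁P₄ (suc M)
    ≈⟨ ⊛-congʳ (C ⊛ p₄) (⊛-cong (rescale-cong (- 1ℤ) (partialProd-2*suc 1 M)) (partialProd-2*suc 1 M)) ⟩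
  (A ⊛ (B ⊛ p)) [-q] ⊛ (A ⊛ (B ⊛ p)) ⊛ (C ⊛ p₄)
    ≈⟨ ⊛-congʳ (C ⊛ p₄) (⊛-congʳ (A ⊛ (B ⊛ p)) [-q]-expand) ⟩
  (A [-q] ⊛ (B [-q] ⊛ p [-q])) ⊛ (A ⊛ (B ⊛ p)) ⊛ (C ⊛ p₄)
    ≈⟨ rearrange (A [-q]) A (B [-q]) B C (p [-q]) p p₄ ⟩
  (A [-q] ⊛ A ⊛ C ⊛ (B [-q] ⊛ B)) ⊛ (p [-q] ⊛ p ⊛ p₄)
    ≈⟨ ⊛-congʳ (p [-q] ⊛ p ⊛ p₄) (⊛-cong (⊛-congʳ C (⊛-cong A[-q]≗G A≗G)) B[-q]B≗B₂) ⟩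
  new-factors M ⊛ P₁[-q]P₁P₄ M
    ∎
  where
  open ≗-Reasoning
  d  = 2 ℕ.* M
  A  = oneMinusQ (1 ℕ.* suc (suc d))
  B  = oneMinusQ (1 ℕ.* suc d)
  C  = oneMinusQ (4 ℕ.* suc M)
  p  = partialProd 1 d
  p₄ = partialProd 4 M
  [-q]-expand : (A ⊛ (B ⊛ p)) [-q] ≗ A [-q] ⊛ (B [-q] ⊛ p [-q])
  [-q]-expand n = trans (rescale-⊛ (- 1ℤ) A (B ⊛ p) n) (⊛-congˡ (A [-q]) (rescale-⊛ (- 1ℤ) B p) n)
  rearrange : ∀ a a′ b b′ c x y z →
              (a ⊛ (b ⊛ x)) ⊛ (a′ ⊛ (b′ ⊛ y)) ⊛ (c ⊛ z) ≗ (a ⊛ a′ ⊛ c ⊛ (b ⊛ b′)) ⊛ (x ⊛ y ⊛ z)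
  rearrange = solve 8 (λ a a′ b b′ c x y z →
    (a :* (b :* x)) :* (a′ :* (b′ :* y)) :* (c :* z) := (a :* a′ :* c :* (b :* b′)) :* (x :* y :* z)) (λ _ → refl)
  A≗G : A ≗ oneMinusQ (2 ℕ.* suc M)
  A≗G = oneMinusQ-cong (index M)
    where
    index : ∀ M → 1 ℕ.* suc (suc (2 ℕ.* M)) ≡ 2 ℕ.* suc M
    index = ℕ-Solver.solve-∀
  A[-q]≗G : A [-q] ≗ oneMinusQ (2 ℕ.* suc M)
  A[-q]≗G n = trans (rescale-oneMinusQ-fixed (- 1ℤ) _ (-1^even (divides (suc M) (index M))) n) (A≗G n)
    where
    index : ∀ M → 1 ℕ.* suc (suc (2 ℕ.* M)) ≡ suc M ℕ.* 2
    index = ℕ-Solver.solve-∀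
  B[-q]B≗B₂ : B [-q] ⊛ B ≗ oneMinusQ (2 ℕ.* suc d)
  B[-q]B≗B₂ n = trans (oneMinusQ[-q]⊛oneMinusQ-odd _ [-1]ᴷ≡-1 n) (oneMinusQ-cong (double d) n)
    where
    [-1]ᴷ≡-1 : (- 1ℤ) ^ (1 ℕ.* suc d) ≡ - 1ℤ
    [-1]ᴷ≡-1 = trans (cong ((- 1ℤ) ^_) (ℕₚ.*-identityˡ (suc d))) (-1^odd (divides M (ℕₚ.*-comm 2 M)))
    double : ∀ d → 1 ℕ.* suc d ℕ.+ 1 ℕ.* suc d ≡ 2 ℕ.* suc d
    double = ℕ-Solver.solve-∀

P₂³-step : ∀ M → P₂³ (suc M) ≗ new-factors M ⊛ P₂³ M
P₂³-step M = begin
  P₂³ (suc M)                          ≈⟨ ⊛-congʳ (G ⊛ r) (⊛-congʳ (G ⊛ r) (partialProd-2*suc 2 M)) ⟩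
  (A ⊛ (B₂ ⊛ q)) ⊛ (G ⊛ r) ⊛ (G ⊛ r)   ≈⟨ rearrange A B₂ G q r ⟩
  (G ⊛ G ⊛ A ⊛ B₂) ⊛ (q ⊛ r ⊛ r)       ≈⟨ ⊛-congʳ (q ⊛ r ⊛ r) (⊛-congʳ B₂ (⊛-congˡ (G ⊛ G) A≗C)) ⟩
  new-factors M ⊛ P₂³ M                ∎
  where
  open ≗-Reasoning
  d  = 2 ℕ.* M
  A  = oneMinusQ (2 ℕ.* suc (suc d))
  B₂ = oneMinusQ (2 ℕ.* suc d)
  G  = oneMinusQ (2 ℕ.* suc M)
  q  = partialProd 2 d
  r  = partialProd 2 M
  A≗C : A ≗ oneMinusQ (4 ℕ.* suc M)
  A≗C = oneMinusQ-cong (index M)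
    where
    index : ∀ M → 2 ℕ.* suc (suc (2 ℕ.* M)) ≡ 4 ℕ.* suc M
    index = ℕ-Solver.solve-∀
  rearrange : ∀ a b g q r → (a ⊛ (b ⊛ q)) ⊛ (g ⊛ r) ⊛ (g ⊛ r) ≗ (g ⊛ g ⊛ a ⊛ b) ⊛ (q ⊛ r ⊛ r)
  rearrange = solve 5 (λ a b g q r → (a :* (b :* q)) :* (g :* r) :* (g :* r) := (g :* g :* a :* b) :* (q :* r :* r))
                      (λ _ → refl)

P₁[-q]P₁P₄≗P₂³ : ∀ M → P₁[-q]P₁P₄ M ≗ P₂³ M
P₁[-q]P₁P₄≗P₂³ zero    = ⊛-congʳ one (⊛-congʳ one (rescale-one (- 1ℤ)))
P₁[-q]P₁P₄≗P₂³ (suc M) = begin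
  P₁[-q]P₁P₄ (suc M)             ≈⟨ P₁[-q]P₁P₄-step M ⟩
  new-factors M ⊛ P₁[-q]P₁P₄ M   ≈⟨ ⊛-congˡ (new-factors M) (P₁[-q]P₁P₄≗P₂³ M) ⟩
  new-factors M ⊛ P₂³ M          ≈⟨ P₂³-step M ⟨
  P₂³ (suc M)                    ∎
  where open ≗-Reasoning

f₁[-q]f₁f₄≗f₂³ : f 1 [-q] ⊛ f 1 ⊛ f 4 ≗ f 2 ⊛ f 2 ⊛ f 2
f₁[-q]f₁f₄≗f₂³ =
  limit-≗ (⊛-⟶ (⊛-⟶ (rescale-⟶ (- 1ℤ) (partialProd-⟶ 0 n≤2n)) (partialProd-⟶ 0 n≤2n)) (partialProd-⟶ 3 n≤n))
          (⊛-⟶ (⊛-⟶ (partialProd-⟶ 1 n≤2n) (partialProd-⟶ 1 n≤n)) (partialProd-⟶ 1 n≤n))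
          P₁[-q]P₁P₄≗P₂³
  where
  n≤n : ∀ n → n ≤ n
  n≤n _ = ℕₚ.≤-refl
  n≤2n : ∀ n → n ≤ 2 ℕ.* n
  n≤2n n = ℕₚ.m≤m+n n (n ℕ.+ 0)

-- The ratio f_j(-q) / f_j

ratio : ℕ → PS
ratio j = f j [-q] ⊛ inv (f j)

ratio-coeff-zero : ∀ j → ratio j 0 ≡ 1ℤ
ratio-coeff-zero j = ⊛-coeff-zero (f j [-q]) (inv (f j))

f[-q]≗f⊛ratio : ∀ j → f j [-q] ≗ f j ⊛ ratio j
f[-q]≗f⊛ratio j = begin
  f j [-q]                       ≈⟨ ⊛-identityʳ (f j [-q]) ⟨
  f j [-q] ⊛ one                 ≈⟨ ⊛-congˡ (f j [-q]) (⊛-inv (f j) refl) ⟨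
  f j [-q] ⊛ (f j ⊛ inv (f j))   ≈⟨ x⊛[y⊛z]≗y⊛[x⊛z] (f j [-q]) (f j) (inv (f j)) ⟩
  f j ⊛ ratio j                  ∎
  where open ≗-Reasoning

ratio-square : ∀ j → ratio j ⊛ ratio j ≈ one [mod + 4 ]
ratio-square j = begin
  ratio j ⊛ ratio j                      ≈⟨ ≗⇒≈-mod (+ 4) (⊛-interchange (f j [-q]) f⁻¹ (f j [-q]) f⁻¹) ⟩
  (f j [-q] ⊛ f j [-q]) ⊛ (f⁻¹ ⊛ f⁻¹)    ≈⟨ ⊛-congʳ-mod (f⁻¹ ⊛ f⁻¹) ([-q]-square (f j)) ⟩
  (f j ⊛ f j) ⊛ (f⁻¹ ⊛ f⁻¹)              ≈⟨ ≗⇒≈-mod (+ 4) (⊛-interchange (f j) (f j) f⁻¹ f⁻¹) ⟩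
  (f j ⊛ f⁻¹) ⊛ (f j ⊛ f⁻¹)              ≈⟨ ≗⇒≈-mod (+ 4) (⊛-cong (⊛-inv (f j) refl) (⊛-inv (f j) refl)) ⟩
  one ⊛ one                              ≈⟨ ≗⇒≈-mod (+ 4) (⊛-identityˡ one) ⟩
  one                                    ∎
  where
  open ≈-mod-Reasoning (+ 4)
  f⁻¹ = inv (f j)

zpow-f[-q] : ∀ j e → zpow (f j) e [-q] ≗ zpow (f j) e ⊛ zpow (ratio j) e
zpow-f[-q] j e = begin
  zpow (f j) e [-q]                 ≈⟨ rescale-zpow (- 1ℤ) (f j) e refl ⟩
  zpow (f j [-q]) e                 ≈⟨ zpow-cong e refl (f[-q]≗f⊛ratio j) ⟩
  zpow (f j ⊛ ratio j) e            ≈⟨ zpow-⊛ (f j) (ratio j) e refl (ratio-coeff-zero j) ⟩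
  zpow (f j) e ⊛ zpow (ratio j) e   ∎
  where open ≗-Reasoning

ratio₁≗ : ratio 1 ≗ (f 2 ⊛ f 2 ⊛ f 2) ⊛ (inv (f 1) ⊛ inv (f 1) ⊛ inv (f 4))
ratio₁≗ = begin
  f₁ [-q] ⊛ i₁                           ≈⟨ ⊛-identityʳ (f₁ [-q] ⊛ i₁) ⟨
  f₁ [-q] ⊛ i₁ ⊛ one                     ≈⟨ ⊛-identityʳ (f₁ [-q] ⊛ i₁ ⊛ one) ⟨
  f₁ [-q] ⊛ i₁ ⊛ one ⊛ one
    ≈⟨ ⊛-cong (⊛-congˡ (f₁ [-q] ⊛ i₁) (⊛-inv f₁ refl)) (⊛-inv f₄ refl) ⟨
  f₁ [-q] ⊛ i₁ ⊛ (f₁ ⊛ i₁) ⊛ (f₄ ⊛ i₄)   ≈⟨ rearrange (f₁ [-q]) f₁ f₄ i₁ i₄ ⟩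
  (f₁ [-q] ⊛ f₁ ⊛ f₄) ⊛ (i₁ ⊛ i₁ ⊛ i₄)   ≈⟨ ⊛-congʳ (i₁ ⊛ i₁ ⊛ i₄) f₁[-q]f₁f₄≗f₂³ ⟩
  (f 2 ⊛ f 2 ⊛ f 2) ⊛ (i₁ ⊛ i₁ ⊛ i₄)     ∎
  where
  open ≗-Reasoning
  f₁ = f 1
  f₄ = f 4
  i₁ = inv f₁
  i₄ = inv f₄
  rearrange : ∀ g a b u v → g ⊛ u ⊛ (a ⊛ u) ⊛ (b ⊛ v) ≗ (g ⊛ a ⊛ b) ⊛ (u ⊛ u ⊛ v)
  rearrange = solve 5 (λ g a b u v → g :* u :* (a :* u) :* (b :* v) := (g :* a :* b) :* (u :* u :* v)) (λ _ → refl)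

f₁²f₂f₄⁻¹≗ : f 1 ⊛ f 1 ⊛ f 2 ⊛ inv (f 4)
             ≗ ((f 1 ⊛ f 1) ⊛ (f 1 ⊛ f 1) ⊛ f 2) ⊛ (inv (f 1) ⊛ inv (f 1) ⊛ inv (f 4))
f₁²f₂f₄⁻¹≗ = begin
  f₁ ⊛ f₁ ⊛ f 2 ⊛ i₄                            ≈⟨ ⊛-identityʳ (f₁ ⊛ f₁ ⊛ f 2 ⊛ i₄) ⟨
  f₁ ⊛ f₁ ⊛ f 2 ⊛ i₄ ⊛ one                      ≈⟨ ⊛-identityʳ (f₁ ⊛ f₁ ⊛ f 2 ⊛ i₄ ⊛ one) ⟨
  f₁ ⊛ f₁ ⊛ f 2 ⊛ i₄ ⊛ one ⊛ one
    ≈⟨ ⊛-cong (⊛-congˡ (f₁ ⊛ f₁ ⊛ f 2 ⊛ i₄) (⊛-inv f₁ refl)) (⊛-inv f₁ refl) ⟨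
  f₁ ⊛ f₁ ⊛ f 2 ⊛ i₄ ⊛ (f₁ ⊛ i₁) ⊛ (f₁ ⊛ i₁)    ≈⟨ rearrange f₁ (f 2) i₁ i₄ ⟩
  ((f₁ ⊛ f₁) ⊛ (f₁ ⊛ f₁) ⊛ f 2) ⊛ (i₁ ⊛ i₁ ⊛ i₄) ∎
  where
  open ≗-Reasoning
  f₁ = f 1
  i₁ = inv f₁
  i₄ = inv (f 4)
  rearrange : ∀ a b u v → a ⊛ a ⊛ b ⊛ v ⊛ (a ⊛ u) ⊛ (a ⊛ u) ≗ ((a ⊛ a) ⊛ (a ⊛ a) ⊛ b) ⊛ (u ⊛ u ⊛ v)
  rearrange = solve 4 (λ a b u v → a :* a :* b :* v :* (a :* u) :* (a :* u) := ((a :* a) :* (a :* a) :* b) :* (u :* u :* v))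
                      (λ _ → refl)

f₂²≈f₁⁴ : f 2 ⊛ f 2 ≈ (f 1 ⊛ f 1) ⊛ (f 1 ⊛ f 1) [mod + 4 ]
f₂²≈f₁⁴ = ≈-mod-sym (square-cong-mod-2 (f-square 0))

ratio₁≈ : ratio 1 ≈ f 1 ⊛ f 1 ⊛ f 2 ⊛ inv (f 4) [mod + 4 ]
ratio₁≈ = begin
  ratio 1                                 ≈⟨ ≗⇒≈-mod (+ 4) ratio₁≗ ⟩
  (f 2 ⊛ f 2 ⊛ f 2) ⊛ I                   ≈⟨ ⊛-congʳ-mod I (⊛-congʳ-mod (f 2) f₂²≈f₁⁴) ⟩
  ((f 1 ⊛ f 1) ⊛ (f 1 ⊛ f 1) ⊛ f 2) ⊛ I   ≈⟨ ≗⇒≈-mod (+ 4) f₁²f₂f₄⁻¹≗ ⟨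
  f 1 ⊛ f 1 ⊛ f 2 ⊛ inv (f 4)             ∎
  where
  open ≈-mod-Reasoning (+ 4)
  I = inv (f 1) ⊛ inv (f 1) ⊛ inv (f 4)

-- Eta quotients under q ↦ -q

factor-[-q] : ∀ j k → (j % 2 ≡ 1 → + 2 ∣ k) → zpow (f j) k [-q] ≈ zpow (f j) k [mod + 4 ]
factor-[-q] j k odd-j⇒even-k with even⊎odd j
... | inj₁ 2∣j = ≗⇒≈-mod (+ 4) (λ n →
  trans (rescale-zpow (- 1ℤ) (f j) k refl n) (zpow-cong k refl (rescale-f (- 1ℤ) j (-1^even 2∣j)) n))
... | inj₂ (q , j≡2q+1) = begin
  zpow (f j) k [-q]                  ≈⟨ ≗⇒≈-mod (+ 4) (zpow-f[-q] j k) ⟩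
  zpow (f j) k ⊛ zpow (ratio j) k    ≈⟨ ⊛-congˡ-mod (zpow (f j) k) (zpow-even (ratio-square j) (ratio-coeff-zero j) k 2∣k) ⟩
  zpow (f j) k ⊛ one                 ≈⟨ ≗⇒≈-mod (+ 4) (⊛-identityʳ (zpow (f j) k)) ⟩
  zpow (f j) k                       ∎
  where
  open ≈-mod-Reasoning (+ 4)
  2∣k : + 2 ∣ k
  2∣k = odd-j⇒even-k (trans (cong (_% 2) j≡2q+1) ([m+kn]%n≡m%n 1 q 2))

factor₁-[-q] : ∀ k → ¬ (+ 2 ∣ k) → zpow (f 1) k [-q] ≈ zpow (f 1) k ⊛ ratio 1 [mod + 4 ]
factor₁-[-q] k k-odd = ≈-mod-trans (≗⇒≈-mod (+ 4) (zpow-f[-q] 1 k))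
                                   (⊛-congˡ-mod (zpow (f 1) k) (zpow-odd (ratio-square 1) (ratio-coeff-zero 1) k k-odd))

etaQuot-[-q] : ∀ N e → ¬ (+ 2 ∣ e 1) → (∀ j → 1 < j → j % 2 ≡ 1 → + 2 ∣ e j) →
               etaQuot (suc N) e [-q] ≈ etaQuot (suc N) e ⊛ ratio 1 [mod + 4 ]
etaQuot-[-q] zero e e₁-odd _ = begin
  (Z ⊛ one) [-q]       ≈⟨ ≗⇒≈-mod (+ 4) (rescale-cong (- 1ℤ) (⊛-identityʳ Z)) ⟩
  Z [-q]               ≈⟨ factor₁-[-q] (e 1) e₁-odd ⟩
  Z ⊛ ratio 1          ≈⟨ ≗⇒≈-mod (+ 4) (⊛-congʳ (ratio 1) (⊛-identityʳ Z)) ⟨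
  Z ⊛ one ⊛ ratio 1    ∎
  where
  open ≈-mod-Reasoning (+ 4)
  Z = zpow (f 1) (e 1)
etaQuot-[-q] (suc N) e e₁-odd eⱼ-even = begin
  (Z ⊛ E) [-q]         ≈⟨ ≗⇒≈-mod (+ 4) (rescale-⊛ (- 1ℤ) Z E) ⟩
  Z [-q] ⊛ E [-q]      ≈⟨ ⊛-cong-mod Z[-q]≈Z (etaQuot-[-q] N e e₁-odd eⱼ-even) ⟩
  Z ⊛ (E ⊛ ratio 1)    ≈⟨ ≗⇒≈-mod (+ 4) (⊛-assoc Z E (ratio 1)) ⟨
  Z ⊛ E ⊛ ratio 1      ∎
  where
  open ≈-mod-Reasoning (+ 4)
  j = 2 ℕ.+ N
  Z = zpow (f j) (e j)
  E = etaQuot (suc N) e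
  Z[-q]≈Z : Z [-q] ≈ Z [mod + 4 ]
  Z[-q]≈Z = factor-[-q] j (e j) (eⱼ-even j (s≤s (s≤s z≤n)))

[-q]-coefficients : ∀ {a b m} → b ≈ a [-q] [mod m ] → ∀ n →
                    (m ∣ a (2 ℕ.* n) - b (2 ℕ.* n)) × (m ∣ a (suc (2 ℕ.* n)) + b (suc (2 ℕ.* n)))
[-q]-coefficients {a} {b} {m} b≈a[-q] n =
    Signed.∣⇒∣ᵤ (subst (m Signed.∣_) even (Signed.∣m⇒∣-m (∣-coeff b≈a[-q] (2 ℕ.* n))))
  , Signed.∣⇒∣ᵤ (subst (m Signed.∣_) odd (∣-coeff b≈a[-q] (suc (2 ℕ.* n))))
  where
  [-1]²ⁿ≡1 : (- 1ℤ) ^ (2 ℕ.* n) ≡ 1ℤ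
  [-1]²ⁿ≡1 = -1^even (divides n (ℕₚ.*-comm 2 n))
  even : - (b (2 ℕ.* n) - (- 1ℤ) ^ (2 ℕ.* n) * a (2 ℕ.* n)) ≡ a (2 ℕ.* n) - b (2 ℕ.* n)
  even = trans (cong (λ s → - (b (2 ℕ.* n) - s * a (2 ℕ.* n))) [-1]²ⁿ≡1) (flip (a (2 ℕ.* n)) (b (2 ℕ.* n)))
    where
    flip : ∀ x y → - (y - 1ℤ * x) ≡ x - y
    flip = solve-∀
  odd : b (suc (2 ℕ.* n)) - - 1ℤ * (- 1ℤ) ^ (2 ℕ.* n) * a (suc (2 ℕ.* n)) ≡ a (suc (2 ℕ.* n)) + b (suc (2 ℕ.* n))
  odd = trans (cong (λ s → b (suc (2 ℕ.* n)) - - 1ℤ * s * a (suc (2 ℕ.* n))) [-1]²ⁿ≡1)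
              (flip (a (suc (2 ℕ.* n))) (b (suc (2 ℕ.* n))))
    where
    flip : ∀ x y → y - - 1ℤ * 1ℤ * x ≡ x + y
    flip = solve-∀

theorem2p3 : (N : ℕ) (e : ℕ → ℤ)
    → (∀ j → N < j → e j ≡ + 0)
    → ¬ ((+ 2) ∣ e 1)
    → (∀ j → 1 < j → j % 2 ≡ 1 → (+ 2) ∣ e j)
    → let A = etaQuot N e
          B = A ⊛ powN (f 1) 2 ⊛ f 2 ⊛ inv (f 4)
      in ∀ (n : ℕ)
         → ((+ 4) ∣ (A (2 ℕ.* n) - B (2 ℕ.* n)))
           Data.Product.× ((+ 4) ∣ (A (suc (2 ℕ.* n)) + B (suc (2 ℕ.* n))))
-- The vanishing hypothesis matters only for N = 0, where it forces the odd exponent e 1 to be 0.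
theorem2p3 zero    e vanish e₁-odd _ _ = contradiction (subst (+ 2 ∣_) (sym (vanish 1 (s≤s z≤n))) (divides 0 refl)) e₁-odd
theorem2p3 (suc N) e _      e₁-odd eⱼ-even = [-q]-coefficients (begin
  A ⊛ powN (f 1) 2 ⊛ f 2 ⊛ inv (f 4)   ≈⟨ ≗⇒≈-mod (+ 4) (⊛-congʳ (inv (f 4)) (⊛-congʳ (f 2) (⊛-congˡ A f₁²≗f₁⊛f₁))) ⟩
  A ⊛ (f 1 ⊛ f 1) ⊛ f 2 ⊛ inv (f 4)    ≈⟨ ≗⇒≈-mod (+ 4) (regroup A (f 1 ⊛ f 1) (f 2) (inv (f 4))) ⟩
  A ⊛ (f 1 ⊛ f 1 ⊛ f 2 ⊛ inv (f 4))    ≈⟨ ⊛-congˡ-mod A ratio₁≈ ⟨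
  A ⊛ ratio 1                          ≈⟨ etaQuot-[-q] N e e₁-odd eⱼ-even ⟨
  A [-q]                               ∎)
  where
  open ≈-mod-Reasoning (+ 4)
  A = etaQuot (suc N) e
  f₁²≗f₁⊛f₁ : powN (f 1) 2 ≗ f 1 ⊛ f 1
  f₁²≗f₁⊛f₁ = ⊛-congˡ (f 1) (⊛-identityʳ (f 1))
  regroup : ∀ a b c d → a ⊛ b ⊛ c ⊛ d ≗ a ⊛ (b ⊛ c ⊛ d)
  regroup = solve 4 (λ a b c d → a :* b :* c :* d := a :* (b :* c :* d)) (λ _ → refl)
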